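{- Let ${\cal M}$ be a DSTL model (as in the context), $\mathsf{m}$ one of its components, and $F,F'$ DSL formulae. If ${\cal M}\models_T\text{stable }\mathsf{m}F$ and ${\cal M}\models_T\text{stable }\mathsf{m}F'$, then ${\cal M}\models_T (\mathsf{m}F\wedge\mathsf{m}F')\rightarrow\mathsf{m}(F\wedge F')$. (Soundness of the confluence rule Conf.)
   Context: A system has finitely many components $m_1,\dots,m_k$. Each component $m_i$ has a sequence of states; $S_i$ is its set of states, with $S_i\cap S_j=\emptyset$ for $i\neq j$, and $S=\bigcup_i S_i$. The next-state relation $R\subseteq S\times S$ contains $(s,s')$ iff $s,s'$ are states of the same component with $s'$ immediately following $s$, or there is a communication (message) from $s$ to $s'$. $R^=$ is the reflexive closure and $R^*$ the reflexive–transitive closure of $R$. Distributed states are arbitrary elements $ds\in DS=2^S$. Define $ds\le ds'$ iff every $s\in ds$ has some $s'\in ds'$ with $(s,s')\in R^*$ and every $s'\in ds'$ has some $s\in ds$ with $(s,s')\in R^*$; $ds\le_c ds'$ is defined the same way with $R^=$ in place of $R^*$. A DSTL model is $(DS,R_1,\dots,R_k,\le,\le_c,V)$ where $(ds,ds')\in R_i$ iff $ds'=\{s\}$ with $s\in S_i\cap ds$, and $V:DS\to 2^P$ satisfies $V(ds)=\bigcap_{s\in ds}V(\{s\})$. DSL formulae ($F::=p\mid\bot\mid\sim F\mid F\wedge F'\mid\mathsf{m}_iF$, with $\top=\sim\bot$) are evaluated at $ds$ by: $ds\models p$ iff $p\in V(ds)$; boolean connectives as usual; $ds\models\mathsf{m}_iF$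 iff there is $s\in ds\cap S_i$ with $\{s\}\models F$. DSTL satisfaction: ${\cal M}\models_T F$ (for a DSL formula $F$) iff every $ds\in DS$ satisfies $F$; ${\cal M}\models_T F\text{ unless }F'$ iff for every $ds\models F$ there is $ds'$ with $ds\le_c ds'$ such that either ($ds'\not\supseteq ds$ and $ds'\models F$) or $ds'\models F'$; $\text{stable }F$ abbreviates $F\text{ unless }\bot$. -}

module Defs where

open import Data.Nat using (ℕ; suc; _<_)
open import Data.Fin using (Fin)
open import Data.Maybe using (Maybe; just; nothing)
open import Data.Unit using (⊤)
open import Data.Empty renaming (⊥ to Empty)
open import Data.Product using (Σ; _×_; _,_; proj₁)
open import Data.Sum using (_⊎_)
open import Relation.Nullary using (¬_)
open import Relation.Binary.PropositionalEquality using (_≡_; _≢_)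
open import Relation.Binary.Construct.Closure.Reflexive using (ReflClosure)
open import Relation.Binary.Construct.Closure.ReflexiveTransitive using (Star)

-- Component i has a sequence
-- of states indexed by positions 0,1,2,...; its length is  len i
-- (nothing = infinite sequence, just l = the l states 0..l-1).

InRange : Maybe ℕ → ℕ → Set
InRange nothing  n = ⊤
InRange (just l) n = n < l

-- A state is (component i , position n , n in range).  The sets S_i are
-- pairwise disjoint by construction; S = State.
State : (k : ℕ) → (Fin k → Maybe ℕ) → Set
State k len = Σ (Fin k) λ i → Σ ℕ λ n → InRange (len i) n

comp : ∀ {k len} → State k len → Fin k
comp = proj₁

record System : Set₁ where
  field
    k   : ℕ
    len : Fin k → Maybe ℕ
    Msg : State k len → State k len → Set
    msg-between : ∀ {s s'} → Msg s s' → comp s ≢ comp s'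

module _ (Sys : System) where
  open System Sys

  St : Set
  St = State k len

  data R : St → St → Set where
    next : ∀ {i n} (p : InRange (len i) n) (q : InRange (len i) (suc n)) →
           R (i , n , p) (i , suc n , q)
    msg  : ∀ {s s'} → Msg s s' → R s s'

  R⁼ : St → St → Set
  R⁼ = ReflClosure R

  R* : St → St → Set
  R* = Star R

  DS : Set₁
  DS = St → Set

  singleton : St → DS
  singleton s = λ t → t ≡ s

  _⊆_ : DS → DS → Set
  ds ⊆ ds' = ∀ s → ds s → ds' s

  _≤ds_ : DS → DS → Set
  ds ≤ds ds' = (∀ s → ds s → Σ St λ s' → ds' s' × R* s s')
             × (∀ s' → ds' s' → Σ St λ s → ds s × R* s s')

  _≤c_ : DS → DS → Set
  ds ≤c ds' = (∀ s → ds s → Σ St λ s' → ds' s' × R⁼ s s')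
            × (∀ s' → ds' s' → Σ St λ s → ds s × R⁼ s s')

  Rᵢ : Fin k → DS → DS → Set₁
  Rᵢ i ds ds' = Σ St λ s → (ds s × comp s ≡ i) × (ds' ≡ singleton s)

record Model : Set₂ where
  field
    sys : System
    P   : Set
    V   : DS sys → P → Set
    V-meet : ∀ ds p → (V ds p → (∀ s → ds s → V (singleton sys s) p))
                    × ((∀ s → ds s → V (singleton sys s) p) → V ds p)
  open System sys public

data Form (M : Model) : Set where
  var : Model.P M → Form M
  ⊥   : Form M
  ∼_  : Form M → Form M
  _∧_ : Form M → Form M → Form M
  m   : Fin (Model.k M) → Form M → Form M

infixr 6 _∧_
infixr 5 _⇒_

⊤F : ∀ {M} → Form M
⊤F = ∼ ⊥

_⇒_ : ∀ {M} → Form M → Form M → Form M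
F ⇒ G = ∼ (F ∧ ∼ G)

_⊨_ : ∀ {M} → DS (Model.sys M) → Form M → Set
_⊨_ {M} ds (var p) = Model.V M ds p
_⊨_ {M} ds ⊥       = Empty
_⊨_ {M} ds (∼ F)   = ¬ (ds ⊨ F)
_⊨_ {M} ds (F ∧ G) = (ds ⊨ F) × (ds ⊨ G)
_⊨_ {M} ds (m i F) =
  Σ (St (Model.sys M)) λ s → ds s × comp s ≡ i × (singleton (Model.sys M) s ⊨ F)

valid : (M : Model) → Form M → Set₁
valid M F = ∀ (ds : DS (Model.sys M)) → ds ⊨ F

validUnless : (M : Model) → Form M → Form M → Set₁
validUnless M F F' =
  ∀ (ds : DS (Model.sys M)) → ds ⊨ F →
    Σ (DS (Model.sys M)) λ ds' → _≤c_ (Model.sys M) ds ds' ×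
      ((¬ (_⊆_ (Model.sys M) ds ds') × ds' ⊨ F) ⊎ ds' ⊨ F')

validStable : (M : Model) → Form M → Set₁
validStable M F = validUnless M F ⊥

-- Inside one component the only R-step is the move to the next position, since
-- messages always cross components.  So if m i F is stable, the witness that
-- stability provides for the singleton {s} of a state s ∈ S_i (which must differ
-- from s) is the successor of s, and F propagates forward along the sequence of
-- component i.  Of the two witnesses of m i F and m i F' in a distributed state,
-- the later one therefore satisfies both F and F'.
module Submission where

open import Defs
open import Data.Fin using (Fin)
open import Data.Nat using (ℕ; zero; suc; _+_; _∸_; _≤_)
open import Data.Nat.Properties using (<-irrelevant; +-comm; ≤-total; m+[n∸m]≡n)
open import Data.Maybe using (just; nothing)
open import Data.Unit using (tt)
open import Data.Empty using (⊥-elim)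
open import Data.Product using (Σ; _×_; _,_; proj₁; proj₂)
open import Data.Sum using (inj₁; inj₂)
open import Relation.Binary.PropositionalEquality
open import Relation.Binary.Construct.Closure.Reflexive using ([_]; refl)

position : ∀ {k len} → State k len → ℕ
position s = proj₁ (proj₂ s)

InRange-irrelevant : ∀ l n (p q : InRange l n) → p ≡ q
InRange-irrelevant nothing  n tt tt = refl
InRange-irrelevant (just l) n p q = <-irrelevant p q

State-≡ : ∀ {k len} (s t : State k len) →
          comp s ≡ comp t → position s ≡ position t → s ≡ t
State-≡ {len = len} (j , n , p) (.j , .n , q) refl refl =
  cong (λ r → j , n , r) (InRange-irrelevant (len j) n p q)

module _ (Sys : System) where
  open System Sys

  R-within-component : ∀ {s t} → R Sys s t → comp s ≡ comp t →
                       position t ≡ suc (position s)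
  R-within-component (next p q) _  = refl
  R-within-component (msg x)    eq = ⊥-elim (msg-between x eq)

  singleton-≤c⇒R⁼ : ∀ {s ds t} → _≤c_ Sys (singleton Sys s) ds → ds t → R⁼ Sys s t
  singleton-≤c⇒R⁼ (_ , back) dst with back _ dst
  ... | _ , refl , s⁼t = s⁼t

module _ (M : Model) (i : Fin (Model.k M)) (F : Form M)
         (stable : validStable M (m i F)) where
  open Model M

  InSᵢ⊨F : St sys → Set
  InSᵢ⊨F s = comp s ≡ i × singleton sys s ⊨ F

  stable-successor : ∀ s → InSᵢ⊨F s →
                     Σ (St sys) λ t → InSᵢ⊨F t × position t ≡ suc (position s)
  stable-successor s (cs , Fs) with stable (singleton sys s) (s , refl , cs , Fs)
  ... | _ , _ , inj₂ ()
  ... | ds , s≤cds , inj₁ (ds⊉s , t , dst , ct , Ft)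
        with singleton-≤c⇒R⁼ sys s≤cds dst
  ...   | refl = ⊥-elim (ds⊉s λ { _ refl → dst })
  ...   | [ st ] = t , (ct , Ft) , R-within-component sys st (trans cs (sym ct))

  stable-forward : ∀ d s → InSᵢ⊨F s →
                   Σ (St sys) λ t → InSᵢ⊨F t × position t ≡ d + position s
  stable-forward zero    s Fs = s , Fs , refl
  stable-forward (suc d) s Fs with stable-forward d s Fs
  ... | t , Ft , t≡d+s with stable-successor t Ft
  ...   | u , Fu , u≡1+t = u , Fu , trans u≡1+t (cong suc t≡d+s)

  stable-monotone : ∀ s t → comp t ≡ i → position s ≤ position t →
                    InSᵢ⊨F s → singleton sys t ⊨ F
  stable-monotone s t ct s≤t Fs
    with stable-forward (position t ∸ position s) s Fs
  ... | u , (cu , Fu) , u≡ = subst (λ v → singleton sys v ⊨ F) u≡t Fu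
    where
    u≡t : u ≡ t
    u≡t = State-≡ u t (trans cu (sym ct)) (begin
      position u                              ≡⟨ u≡ ⟩
      (position t ∸ position s) + position s  ≡⟨ +-comm (position t ∸ position s) _ ⟩
      position s + (position t ∸ position s)  ≡⟨ m+[n∸m]≡n s≤t ⟩
      position t                              ∎)
      where open ≡-Reasoning

mainTheorem3 : (M : Model) (i : Fin (Model.k M)) (F F' : Form M) →
               validStable M (m i F) → validStable M (m i F') →
               valid M ((m i F ∧ m i F') ⇒ m i (F ∧ F'))
mainTheorem3 M i F F' stableF stableF' ds (((s , ds-s , cs , Fs) , (t , ds-t , ct , F't)) , ¬both)
  with ≤-total (position s) (position t)
... | inj₁ s≤t = ¬both (t , ds-t , ct , stable-monotone M i F stableF s t ct s≤t (cs , Fs) , F't)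
... | inj₂ t≤s = ¬both (s , ds-s , cs , Fs , stable-monotone M i F' stableF' t s cs t≤s (ct , F't))
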